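{- Let $G$ be a finite simple graph that has no path factor, and let $H$ be a finite simple graph that has a vertex of degree one. Then the Cartesian product $G\Box H$ is not hamiltonian.
   Context: A path factor of a graph $G$ is a set $\mathcal P$ of pairwise vertex-disjoint paths in $G$, each having at least two vertices, such that $\bigcup_{P\in\mathcal P}V(P)=V(G)$. The Cartesian product $G\Box H$ has vertex set $V(G)\times V(H)$, with $(g_1,h_1)$ adjacent to $(g_2,h_2)$ iff either $g_1=g_2$ and $h_1h_2\in E(H)$, or $g_1g_2\in E(G)$ and $h_1=h_2$. A graph is hamiltonian if it contains a spanning cycle. -}

module Defs where

open import Data.Nat using (ℕ; _≤_)
open import Data.Fin using (Fin)
open import Data.List using (List; []; _∷_; length; concatMap; _++_; take)
open import Data.List.Membership.Propositional using (_∈_)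
open import Data.List.Relation.Unary.Unique.Propositional using (Unique)
open import Data.List.Relation.Unary.Linked using (Linked)
open import Data.Product using (Σ; _×_; _,_; proj₁)
open import Relation.Binary.PropositionalEquality using (_≡_)
open import Relation.Nullary using (¬_)

record SimpleGraph (V : Set) : Set₁ where
  field
    Adj    : V → V → Set
    sym    : ∀ {u v} → Adj u v → Adj v u
    irrefl : ∀ {v} → ¬ Adj v v
open SimpleGraph public

FinGraph : ℕ → Set₁
FinGraph n = SimpleGraph (Fin n)

module _ {V : Set} (G : SimpleGraph V) where

  IsPath2 : List V → Set
  IsPath2 xs = (2 ≤ length xs) × Unique xs × Linked (Adj G) xs

  Path2 : Set
  Path2 = Σ (List V) IsPath2

  IsPathFactor : List Path2 → Set
  IsPathFactor ps =
    Unique (concatMap proj₁ ps) × (∀ v → v ∈ concatMap proj₁ ps)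

  HasPathFactor : Set
  HasPathFactor = Σ (List Path2) IsPathFactor

  IsHamCycle : List V → Set
  IsHamCycle xs =
    (3 ≤ length xs) × Unique xs × Linked (Adj G) (xs ++ take 1 xs)
      × (∀ v → v ∈ xs)

  Hamiltonian : Set
  Hamiltonian = Σ (List V) IsHamCycle

  DegreeOne : V → Set
  DegreeOne v = Σ V λ u → Adj G v u × (∀ w → Adj G v w → w ≡ u)

  HasDegreeOneVertex : Set
  HasDegreeOneVertex = Σ V DegreeOne

module _ {V W : Set} where
  data BoxAdj (G : SimpleGraph V) (H : SimpleGraph W) : V × W → V × W → Set where
    inH : ∀ {g h₁ h₂} → Adj H h₁ h₂ → BoxAdj G H (g , h₁) (g , h₂)
    inG : ∀ {g₁ g₂ h} → Adj G g₁ g₂ → BoxAdj G H (g₁ , h) (g₂ , h)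

  _□_ : SimpleGraph V → SimpleGraph W → SimpleGraph (V × W)
  G □ H = record { Adj = BoxAdj G H ; sym = s ; irrefl = i }
    where
      s : ∀ {u v} → BoxAdj G H u v → BoxAdj G H v u
      s (inH a) = inH (sym H a)
      s (inG a) = inG (sym G a)
      i : ∀ {v} → ¬ BoxAdj G H v v
      i (inH a) = irrefl H a
      i (inG a) = irrefl G a

-- Let h be a leaf of H with neighbour u, and read a hamiltonian cycle of G □ H
-- as a closed walk from a vertex of the fibre G × {u}. Whenever the walk enters
-- the fibre G × {h} it must come from (g , u), and if it left again at once it
-- could only return to (g , u), which a cycle cannot do. So the fibre G × {h}
-- is traversed in maximal runs of at least two vertices; projected to G these
-- runs are vertex-disjoint paths covering V(G), i.e. a path factor of G.
module Submission where

open import Defs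
open import Data.Nat using (ℕ; _≤_; s≤s; z≤n)
import Data.Fin.Properties as Fin
open import Data.Empty using (⊥-elim)
open import Data.Unit using (⊤; tt)
open import Data.Product using (Σ; _×_; _,_; proj₁; proj₂)
open import Data.List using (List; []; _∷_; [_]; _++_; length; concat; concatMap; map; filter)
open import Data.List.Properties using (++-assoc; ++-identityʳ; length-map; concat-map; filter-++; filter-reject)
open import Data.List.Membership.Propositional using (_∈_; _∉_)
open import Data.List.Membership.Propositional.Properties using (∈-∃++; ∈-map⁺; ∈-filter⁺)
open import Data.List.Relation.Unary.Any using (here; there)
open import Data.List.Relation.Unary.All as All using (All; []; _∷_)
open import Data.List.Relation.Unary.All.Properties using (all-filter; All¬⇒¬Any)
import Data.List.Relation.Unary.All.Properties as All
open import Data.List.Relation.Unary.Linked using (Linked; []; [-]; _∷_)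
import Data.List.Relation.Unary.Linked.Properties as Linked
open import Data.List.Relation.Unary.AllPairs using ([]; _∷_)
open import Data.List.Relation.Unary.Unique.Propositional using (Unique)
import Data.List.Relation.Unary.Unique.Propositional.Properties as Unique
import Data.List.Relation.Binary.Permutation.Setoid as Permutation
import Data.List.Relation.Binary.Permutation.Setoid.Properties as PermutationProperties
open import Function using (_on_)
open import Level using (0ℓ)
open import Relation.Binary using (Rel; DecidableEquality)
open import Relation.Binary.PropositionalEquality
  using (_≡_; _≢_; refl; trans; cong; subst; setoid; module ≡-Reasoning) renaming (sym to ≡-sym)
open import Relation.Nullary using (¬_; yes; no)
open import Relation.Unary using (Pred; Decidable)

private
  variable
    A B : Set

Unique-++⁻ : ∀ (xs : List A) {ys} → Unique (xs ++ ys) → Unique xs × Unique ys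
Unique-++⁻ []       u        = [] , u
Unique-++⁻ (x ∷ xs) (x∉ ∷ u) =
  let u₁ , u₂ = Unique-++⁻ xs u in All.++⁻ˡ xs x∉ ∷ u₁ , u₂

module _ {R : Rel A 0ℓ} where

  Linked-split : ∀ xs {y ys} → Linked R (xs ++ y ∷ ys) →
                 Linked R (xs ++ [ y ]) × Linked R (y ∷ ys)
  Linked-split []           l       = [-] , l
  Linked-split (_ ∷ [])     (r ∷ l) = r ∷ [-] , l
  Linked-split (_ ∷ x ∷ xs) (r ∷ l) =
    let l₁ , l₂ = Linked-split (x ∷ xs) l in r ∷ l₁ , l₂

  Linked-join : ∀ xs {y ys} → Linked R (xs ++ [ y ]) → Linked R (y ∷ ys) →
                Linked R (xs ++ y ∷ ys)
  Linked-join []           _        l = l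
  Linked-join (_ ∷ [])     (r ∷ _)  l = r ∷ l
  Linked-join (_ ∷ x ∷ xs) (r ∷ l₁) l = r ∷ Linked-join (x ∷ xs) l₁ l

  Linked-rotate : ∀ as {x} post {p} → Linked R ((p ∷ as ++ x ∷ post) ++ [ p ]) →
                  Linked R (x ∷ (post ++ p ∷ as) ++ [ x ])
  Linked-rotate as {x} post {p} l
    rewrite ++-assoc (p ∷ as) (x ∷ post) [ p ] | ++-assoc post (p ∷ as) [ x ] =
    let l₁ , l₂ = Linked-split (p ∷ as) l in Linked-join (x ∷ post) l₂ l₁

NonBacktracking : List A → Set
NonBacktracking (a ∷ b ∷ c ∷ w) = a ≢ c × NonBacktracking (b ∷ c ∷ w)
NonBacktracking _               = ⊤

NonBacktracking-tail : ∀ {a : A} w → NonBacktracking (a ∷ w) → NonBacktracking w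
NonBacktracking-tail []          _       = tt
NonBacktracking-tail (_ ∷ [])    _       = tt
NonBacktracking-tail (_ ∷ _ ∷ _) (_ , n) = n

Unique-snoc⇒NonBacktracking : ∀ {x : A} xs → Unique xs → x ∉ xs →
                              NonBacktracking (xs ++ [ x ])
Unique-snoc⇒NonBacktracking []              _                   _  = tt
Unique-snoc⇒NonBacktracking (_ ∷ [])        _                   _  = tt
Unique-snoc⇒NonBacktracking (_ ∷ _ ∷ [])    _                   x∉ =
  (λ a≡x → x∉ (here (≡-sym a≡x))) , tt
Unique-snoc⇒NonBacktracking (_ ∷ b ∷ c ∷ w) ((_ ∷ a≢c ∷ _) ∷ u) x∉ =
  a≢c , Unique-snoc⇒NonBacktracking (b ∷ c ∷ w) u (λ x∈ → x∉ (there x∈))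

closedWalk-nonBacktracking : ∀ {x : A} rest → Unique (x ∷ rest) → 2 ≤ length rest →
                             NonBacktracking (x ∷ rest ++ [ x ])
closedWalk-nonBacktracking (_ ∷ []) _ (s≤s ())
closedWalk-nonBacktracking (r₁ ∷ r₂ ∷ rest) ((x≢r₁ ∷ x≢r₂ ∷ x∉rest) ∷ u) _ =
  x≢r₂ , Unique-snoc⇒NonBacktracking (r₁ ∷ r₂ ∷ rest) u (All¬⇒¬Any (x≢r₁ ∷ x≢r₂ ∷ x∉rest))

Run : Rel A 0ℓ → List A → Set
Run S r = 2 ≤ length r × Linked S r

RunDecomposition : Rel A 0ℓ → List A → Set
RunDecomposition S l = Σ (List (List _)) λ rs → All (Run S) rs × concat rs ≡ l

module _ {S : Rel B 0ℓ} (f : A → B) where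

  Run-map : ∀ {r} → Run (S on f) r → Run S (map f r)
  Run-map {r} (long , linked) =
    subst (2 ≤_) (≡-sym (length-map f r)) long , Linked.map⁺ linked

  RunDecomposition-map : ∀ {l} → RunDecomposition (S on f) l → RunDecomposition S (map f l)
  RunDecomposition-map (rs , runs , refl) =
    map (map f) rs , All.map⁺ (All.map Run-map runs) , concat-map rs

-- A run is never a single vertex: the
-- walk would step into P and straight out again, and by `bounces` return to
-- where it came from, which a non-backtracking walk does not do.
module Runs {P : Pred A 0ℓ} (P? : Decidable P) {R S : Rel A 0ℓ}
  (inside : ∀ {a b} → R a b → P a → P b → S a b)
  (bounces : ∀ {a b c} → R a b → ¬ P a → P b → R b c → ¬ P c → a ≡ c) where

  LastOutside : List A → Set
  LastOutside []          = ⊤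
  LastOutside (x ∷ [])    = ¬ P x
  LastOutside (_ ∷ y ∷ w) = LastOutside (y ∷ w)

  Walk : List A → Set
  Walk w = Linked R w × NonBacktracking w × LastOutside w

  Walk-tail : ∀ {a z} zs → Walk (a ∷ z ∷ zs) → Walk (z ∷ zs)
  Walk-tail zs (_ ∷ l , n , o) = l , NonBacktracking-tail (_ ∷ zs) n , o

  mutual
    runsAfterExit : ∀ {a} zs → ¬ P a → Walk (a ∷ zs) → RunDecomposition S (filter P? zs)
    runsAfterExit [] _ _ = [] , [] , refl
    runsAfterExit (z ∷ zs) ¬pa w with P? z
    ... | no ¬pz = runsAfterExit zs ¬pz (Walk-tail zs w)
    runsAfterExit (z ∷ [])      _   (_ , _ , ¬pz) | yes pz = ⊥-elim (¬pz pz)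
    runsAfterExit (z ∷ z′ ∷ zs) ¬pa w@(r ∷ r′ ∷ _ , (a≢z′ , _) , _) | yes pz with P? z′
    ... | no ¬pz′ = ⊥-elim (a≢z′ (bounces r ¬pa pz r′ ¬pz′))
    ... | yes pz′ =
      let run , rs , linked , runs , eq = runContinuing zs pz′ (Walk-tail zs (Walk-tail (z′ ∷ zs) w))
      in (z ∷ z′ ∷ run) ∷ rs , (s≤s (s≤s z≤n) , inside r′ pz pz′ ∷ linked) ∷ runs ,
         cong (λ t → z ∷ z′ ∷ t) eq

    runContinuing : ∀ {b} zs → P b → Walk (b ∷ zs) →
                    Σ (List A) λ run → Σ (List (List A)) λ rs →
                      Linked S (b ∷ run) × All (Run S) rs × run ++ concat rs ≡ filter P? zs
    runContinuing []       _  _ = [] , [] , [-] , [] , refl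
    runContinuing (z ∷ zs) pb w@(r ∷ _ , _) with P? z
    ... | no ¬pz =
      let rs , runs , eq = runsAfterExit zs ¬pz (Walk-tail zs w)
      in [] , rs , [-] , runs , eq
    ... | yes pz =
      let run , rs , linked , runs , eq = runContinuing zs pz (Walk-tail zs w)
      in z ∷ run , rs , inside r pb pz ∷ linked , runs , cong (z ∷_) eq

  LastOutside-snoc : ∀ {x} → ¬ P x → ∀ y w → LastOutside (y ∷ w ++ [ x ])
  LastOutside-snoc ¬px _ []      = ¬px
  LastOutside-snoc ¬px _ (y ∷ w) = LastOutside-snoc ¬px y w

  closedWalk-runs : ∀ {x} rest → ¬ P x → Linked R (x ∷ rest ++ [ x ]) →
                    NonBacktracking (x ∷ rest ++ [ x ]) → RunDecomposition S (filter P? (x ∷ rest))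
  closedWalk-runs {x} rest ¬px linked nonBacktracking =
    subst (RunDecomposition S) filter-closedWalk
      (runsAfterExit (rest ++ [ x ]) ¬px (linked , nonBacktracking , LastOutside-snoc ¬px x rest))
    where
      open ≡-Reasoning
      filter-closedWalk : filter P? (rest ++ [ x ]) ≡ filter P? (x ∷ rest)
      filter-closedWalk = begin
        filter P? (rest ++ [ x ])          ≡⟨ filter-++ P? rest [ x ] ⟩
        filter P? rest ++ filter P? [ x ]  ≡⟨ cong (filter P? rest ++_) (filter-reject P? ¬px) ⟩
        filter P? rest ++ []               ≡⟨ ++-identityʳ _ ⟩
        filter P? rest                     ≡⟨ filter-reject P? ¬px ⟨
        filter P? (x ∷ rest)               ∎

module _ {V : Set} (G : SimpleGraph V) where

  paths-fromRuns : ∀ rs → All (Run (Adj G)) rs → Unique (concat rs) →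
                   Σ (List (Path2 G)) λ ps → concatMap proj₁ ps ≡ concat rs
  paths-fromRuns []       []                    _ = [] , refl
  paths-fromRuns (r ∷ rs) ((long , linked) ∷ runs) u =
    let uʳ , uʳˢ = Unique-++⁻ r u
        ps , eq = paths-fromRuns rs runs uʳˢ
    in (r , long , uʳ , linked) ∷ ps , cong (r ++_) eq

  pathFactor-fromRunDecomposition : ∀ {l} → RunDecomposition (Adj G) l → Unique l →
                                    (∀ v → v ∈ l) → HasPathFactor G
  pathFactor-fromRunDecomposition (rs , runs , refl) u spanning =
    let ps , eq = paths-fromRuns rs runs u
    in ps , subst Unique (≡-sym eq) u , λ v → subst (v ∈_) (≡-sym eq) (spanning v)

IsHamCycle-rotate : ∀ {V : Set} (G : SimpleGraph V) pre {x} post →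
                    IsHamCycle G (pre ++ x ∷ post) → IsHamCycle G (x ∷ post ++ pre)
IsHamCycle-rotate G []       post c =
  subst (IsHamCycle G) (cong (_ ∷_) (≡-sym (++-identityʳ post))) c
IsHamCycle-rotate G (p ∷ as) post (long , u , linked , spanning) =
  subst (3 ≤_) (xs↭ys⇒|xs|≡|ys| rotation) long , Unique-resp-↭ rotation u ,
  Linked-rotate as post linked , λ v → ∈-resp-↭ rotation (spanning v)
  where
    open Permutation (setoid _) using (_↭_)
    open PermutationProperties (setoid _) using (++-comm; xs↭ys⇒|xs|≡|ys|; Unique-resp-↭; ∈-resp-↭)
    rotation : p ∷ as ++ _ ∷ post ↭ _ ∷ post ++ p ∷ as
    rotation = ++-comm (p ∷ as) (_ ∷ post)

module _ {V W : Set} (G : SimpleGraph V) (H : SimpleGraph W) (_≟_ : DecidableEquality W)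
         {h u : W} (hu : Adj H h u) (only-u : ∀ w → Adj H h w → w ≡ u) where

  InFiber : V × W → Set
  InFiber a = proj₂ a ≡ h

  inFiber? : Decidable InFiber
  inFiber? a = proj₂ a ≟ h

  fiber-adj : ∀ {a b} → BoxAdj G H a b → InFiber a → InFiber b → Adj G (proj₁ a) (proj₁ b)
  fiber-adj (inH hh) refl refl = ⊥-elim (irrefl H hh)
  fiber-adj (inG gg) _    _    = gg

  fiber-bounces : ∀ {a b c} → BoxAdj G H a b → ¬ InFiber a → InFiber b →
                  BoxAdj G H b c → ¬ InFiber c → a ≡ c
  fiber-bounces (inG _)           ¬fa fb   _                     _   = ⊥-elim (¬fa fb)
  fiber-bounces (inH _)           _   refl (inG _)               ¬fc = ⊥-elim (¬fc refl)
  fiber-bounces (inH {g} {k} k~h) _   refl (inH {h₂ = k′} h~k′) _   =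
    cong (g ,_) (trans (only-u k (sym H k~h)) (≡-sym (only-u k′ h~k′)))

  fiber-section : ∀ {as} → All InFiber as → map (_, h) (map proj₁ as) ≡ as
  fiber-section []          = refl
  fiber-section (refl ∷ fs) = cong (_ ∷_) (fiber-section fs)

  fiber-unique : ∀ {as} → Unique as → Unique (map proj₁ (filter inFiber? as))
  fiber-unique {as} unique =
    Unique.map⁻ (subst Unique (≡-sym (fiber-section (all-filter inFiber? as)))
                       (Unique.filter⁺ inFiber? unique))

  fiber-spanning : ∀ {as} → (∀ a → a ∈ as) → ∀ g → g ∈ map proj₁ (filter inFiber? as)
  fiber-spanning spanning g = ∈-map⁺ proj₁ (∈-filter⁺ inFiber? (spanning (g , h)) refl)

  open Runs inFiber? {BoxAdj G H} {Adj G on proj₁} fiber-adj fiber-bounces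

  hamCycle-outsideFiber⇒pathFactor : ∀ {x} rest → ¬ InFiber x → IsHamCycle (G □ H) (x ∷ rest) →
                                     HasPathFactor G
  hamCycle-outsideFiber⇒pathFactor rest ¬fx (s≤s long , unique , linked , spanning) =
    pathFactor-fromRunDecomposition G
      (RunDecomposition-map proj₁
        (closedWalk-runs rest ¬fx linked (closedWalk-nonBacktracking rest unique long)))
      (fiber-unique unique) (fiber-spanning spanning)

  hamiltonian⇒pathFactor : Hamiltonian (G □ H) → HasPathFactor G
  hamiltonian⇒pathFactor ((g , _) ∷ cs , cycle@(_ , _ , _ , spanning))
    with pre , post , eq ← ∈-∃++ (spanning (g , u)) =
    hamCycle-outsideFiber⇒pathFactor (post ++ pre) u≢h
      (IsHamCycle-rotate (G □ H) pre post (subst (IsHamCycle (G □ H)) eq cycle))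
    where
      u≢h : u ≢ h
      u≢h u≡h = irrefl H (subst (Adj H h) u≡h hu)

mainTheorem1 : (m n : ℕ) (G : FinGraph m) (H : FinGraph n) →
    ¬ HasPathFactor G → HasDegreeOneVertex H → ¬ Hamiltonian (G □ H)
mainTheorem1 m n G H noPathFactor (h , u , hu , only-u) hamiltonian =
  noPathFactor (hamiltonian⇒pathFactor G H Fin._≟_ hu only-u hamiltonian)
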